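{- Let $\Delta = D_1,\ldots,D_k$ be a legal $\lambda$D-environment, where each $D_i$ has the form $x_1:A_1,\ldots,x_n:A_n \rhd a(x_1,\ldots,x_n) := M : N$ or $x_1:A_1,\ldots,x_n:A_n \rhd a(x_1,\ldots,x_n) := \mathrm{PN} : N$. Let $\mathbf{B}_\Delta$ be the Automath book obtained by replacing each $D_i$, one by one and in order, by the cluster of lines $\epsilon \ast x_1 := \text{ --- } : A_1$, $x_1 \ast x_2 := \text{ --- } : A_2$, $\ldots$, $x_{n-1} \ast x_n := \text{ --- } : A_n$, $x_n \ast a := M : N$ (respectively $x_n \ast a := \mathrm{PN} : N$), where variables and constants are renamed (consistently) as needed so that all identifiers in the book are distinct. Then $\mathbf{B}_\Delta$ is an ok and clean Automath book.
   Context: Terms: fix disjoint infinite sets Var (variables) and Const (constants). Pseudo-terms of the type system $\lambda$D are built from the sorts $\ast$, $\Box$, variables, instantiated constants $c(T_1,\ldots,T_n)$, abstractions $\lambda x{:}T.\,T'$, products $\Pi x{:}T.\,T'$ and applications $T\,T'$. $\lambda$D is the Calculus of Constructions extended with (parametrised) definitions, as in Nederpelt and Geuvers, "Type Theory and Formal Proof" (2014); its judgements have the form $\Delta ; \Gamma \vdash M : N$, where $\Gamma$ is a context $x_1:A_1,\ldots,x_n:A_n$ and $\Delta$ is an environment, i.e. a list of definitions each of the form $\Gamma \rhd c(x_1,\ldots,x_n) := M : A$ or (primitive definition) $\Gamma \rhd c(x_1,\ldots,x_n) := \mathrm{PN} : A$. An environment $\Delta$ is legal if there are $\Gamma, M,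 N$ with $\Delta;\Gamma \vdash M : N$ derivable in $\lambda$D. Automath lines have the form $y \ast z := \text{ --- } : A$ (assumption line, $z\in$ Var), $y \ast c := M : A$ (definition line, $c \in$ Const) or $y \ast c := \mathrm{PN} : A$ (primitive line), where the indicator $y$ is $\epsilon$ or a variable. A book is a finite sequence of lines. A book is coherent if all identifiers of its lines are distinct and every indicator $y \neq \epsilon$ of a line $m$ is the identifier of an assumption line occurring before $m$. For an assumption identifier $z$ with line $y \ast z := \text{ --- } : A$, define recursively $\gamma_z := \gamma_y, z$ and $\Gamma_z := \Gamma_y, z:A$, with $\gamma_\epsilon$, $\Gamma_\epsilon$ empty. "$\mathbf{B}$ ok" and $\Delta_{\mathbf{B}}$ are defined inductively: the empty book is ok with empty environment; if $\mathbf{B}$ is ok then $\mathbf{B} + (z \ast x := \text{ --- } : A)$ is ok if $x$ is fresh for $\mathbf{B}$ and $\Delta_{\mathbf{B}};\Gamma_z \vdash A : s$ for a sort $s\in\{\ast,\Box\}$ (environment unchanged); $\mathbf{B} + (z \ast c := M : A)$ is ok if $c$ is fresh and $\Delta_{\mathbf{B}};\Gamma_z \vdash M : A$ (environment extended by $\Gamma_z \rhd c(\gamma_z) := M : A$); $\mathbf{B} + (z \ast c := \mathrm{PN} : A)$ is ok if $c$ is fresh and $\Delta_{\mathbf{B}};\Gamma_z \vdash A : s$ for a sort $s$ (environment extended by $\Gamma_z \rhd c(\gamma_z) := \mathrm{PN} : A$). An assumption line with identifier $x$ is a dead-end if $x$ is not the indicator of any later line; a coherent book is clean if it has no dead-end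 assumption line. -}

module Defs where

open import Data.Nat using (ℕ; zero; suc; _≟_)
open import Data.List using (List; []; _∷_; _++_; _∷ʳ_; length; map; [_])
open import Data.List.Membership.Propositional using (_∈_; _∉_)
open import Data.List.Relation.Unary.Unique.Propositional using (Unique)
open import Data.Maybe using (Maybe; just; nothing)
open import Data.Product using (Σ; ∃; _×_; _,_; ∃-syntax; proj₁; proj₂)
open import Data.Sum using (_⊎_; inj₁; inj₂)
open import Relation.Nullary using (¬_; yes; no)
open import Relation.Binary.PropositionalEquality using (_≡_)
open import Relation.Binary.Construct.Closure.Equivalence using (EqClosure)
open import Function.Definitions using (Injective)

-- Identifiers: Var and Const are disjoint infinite sets (two copies of ℕ,
-- kept apart by the constructors that use them).

Var : Set
Var = ℕ

Const : Set
Const = ℕ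

-- Pseudo-terms of λD, locally nameless: free variables are names,
-- bound variables are de Bruijn indices (terms taken modulo α).

data Sort : Set where
  ∗ □ : Sort

data Term : Set where
  srt : Sort → Term
  bv  : ℕ → Term
  fv  : Var → Term
  con : Const → List Term → Term
  lam : Term → Term → Term          -- λx:T.T'  (body binds index 0)
  pi  : Term → Term → Term          -- Πx:T.T'  (body binds index 0)
  app : Term → Term → Term

mutual
  openAt : ℕ → Term → Term → Term
  openAt k u (srt s) = srt s
  openAt k u (bv i) with i ≟ k
  ... | yes _ = u
  ... | no  _ = bv i
  openAt k u (fv x) = fv x
  openAt k u (con c ts) = con c (openAts k u ts)
  openAt k u (lam A M) = lam (openAt k u A) (openAt (suc k) u M)
  openAt k u (pi A B) = pi (openAt k u A) (openAt (suc k) u B)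
  openAt k u (app M N) = app (openAt k u M) (openAt k u N)

  openAts : ℕ → Term → List Term → List Term
  openAts k u [] = []
  openAts k u (t ∷ ts) = openAt k u t ∷ openAts k u ts

_^^_ : Term → Term → Term
B ^^ u = openAt 0 u B

mutual
  subst : (Var → Term) → Term → Term
  subst σ (srt s) = srt s
  subst σ (bv i) = bv i
  subst σ (fv x) = σ x
  subst σ (con c ts) = con c (substs σ ts)
  subst σ (lam A M) = lam (subst σ A) (subst σ M)
  subst σ (pi A B) = pi (subst σ A) (subst σ B)
  subst σ (app M N) = app (subst σ M) (subst σ N)

  substs : (Var → Term) → List Term → List Term
  substs σ [] = []
  substs σ (t ∷ ts) = subst σ t ∷ substs σ ts

mutual
  rename : (Var → Var) → (Const → Const) → Term → Term
  rename σ ρ (srt s) = srt s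
  rename σ ρ (bv i) = bv i
  rename σ ρ (fv x) = fv (σ x)
  rename σ ρ (con c ts) = con (ρ c) (renames σ ρ ts)
  rename σ ρ (lam A M) = lam (rename σ ρ A) (rename σ ρ M)
  rename σ ρ (pi A B) = pi (rename σ ρ A) (rename σ ρ B)
  rename σ ρ (app M N) = app (rename σ ρ M) (rename σ ρ N)

  renames : (Var → Var) → (Const → Const) → List Term → List Term
  renames σ ρ [] = []
  renames σ ρ (t ∷ ts) = rename σ ρ t ∷ renames σ ρ ts

mutual
  fvs : Term → List Var
  fvs (srt s) = []
  fvs (bv i) = []
  fvs (fv x) = x ∷ []
  fvs (con c ts) = fvss ts
  fvs (lam A M) = fvs A ++ fvs M
  fvs (pi A B) = fvs A ++ fvs B
  fvs (app M N) = fvs M ++ fvs N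

  fvss : List Term → List Var
  fvss [] = []
  fvss (t ∷ ts) = fvs t ++ fvss ts

infixl 5 _,_∶_
data Ctx : Set where
  ∅     : Ctx
  _,_∶_ : Ctx → Var → Term → Ctx

dom : Ctx → List Var
dom ∅ = []
dom (Γ , x ∶ A) = dom Γ ∷ʳ x

entries : Ctx → List (Var × Term)
entries ∅ = []
entries (Γ , x ∶ A) = entries Γ ∷ʳ (x , A)

-- the substitution [x̄ := Ū] for the parameters x̄ = dom Γ
lookupSub : List Var → List Term → Var → Term
lookupSub (y ∷ ys) (u ∷ us) x with x ≟ y
... | yes _ = u
... | no  _ = lookupSub ys us x
lookupSub _ _ x = fv x

instSub : Ctx → List Term → Var → Term
instSub Γ Us = lookupSub (dom Γ) Us

data Body : Set where
  val : Term → Body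
  PN  : Body

-- Γ ▹ a(dom Γ) := body : N
record Def : Set where
  constructor _▹_≔_∶_
  field
    params : Ctx
    name   : Const
    body   : Body
    type   : Term

infixl 5 _▸_
data Env : Set where
  ◇   : Env
  _▸_ : Env → Def → Env

envList : Env → List Def
envList ◇ = []
envList (Δ ▸ D) = envList Δ ∷ʳ D

names : Env → List Const
names Δ = map Def.name (envList Δ)

_∈ᴱ_ : Def → Env → Set
D ∈ᴱ Δ = D ∈ envList Δ

mutual
  data _⊢_⟶_ (Δ : Env) : Term → Term → Set where
    β    : ∀ {A M N} → Δ ⊢ app (lam A M) N ⟶ ((M ^^ N))
    δ    : ∀ {Γ a M N Us} → (Γ ▹ a ≔ val M ∶ N) ∈ᴱ Δ → length Us ≡ length (dom Γ) →
           Δ ⊢ con a Us ⟶ subst (instSub Γ Us) M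
    conR : ∀ {c ts ts'} → Δ ⊢ ts ⟶s ts' → Δ ⊢ con c ts ⟶ con c ts'
    lamL : ∀ {A A' M} → Δ ⊢ A ⟶ A' → Δ ⊢ lam A M ⟶ lam A' M
    lamR : ∀ {A M M' x} → x ∉ fvs M → x ∉ fvs M' →
           Δ ⊢ ((M ^^ fv x)) ⟶ (M' ^^ fv x) → Δ ⊢ lam A M ⟶ lam A M'
    piL  : ∀ {A A' B} → Δ ⊢ A ⟶ A' → Δ ⊢ pi A B ⟶ pi A' B
    piR  : ∀ {A B B' x} → x ∉ fvs B → x ∉ fvs B' →
           Δ ⊢ ((B ^^ fv x)) ⟶ (B' ^^ fv x) → Δ ⊢ pi A B ⟶ pi A B'
    appL : ∀ {M M' N} → Δ ⊢ M ⟶ M' → Δ ⊢ app M N ⟶ app M' N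
    appR : ∀ {M N N'} → Δ ⊢ N ⟶ N' → Δ ⊢ app M N ⟶ app M N'

  data _⊢_⟶s_ (Δ : Env) : List Term → List Term → Set where
    here  : ∀ {t t' ts} → Δ ⊢ t ⟶ t' → Δ ⊢ (t ∷ ts) ⟶s (t' ∷ ts)
    there : ∀ {t ts ts'} → Δ ⊢ ts ⟶s ts' → Δ ⊢ (t ∷ ts) ⟶s (t ∷ ts')

_⊢_=βδ_ : Env → Term → Term → Set
Δ ⊢ A =βδ B = EqClosure (Δ ⊢_⟶_) A B

infix 4 _⨾_⊢_∶_
data _⨾_⊢_∶_ : Env → Ctx → Term → Term → Set where
  sort  : ◇ ⨾ ∅ ⊢ srt ∗ ∶ srt □
  var   : ∀ {Δ Γ A s x} → Δ ⨾ Γ ⊢ A ∶ srt s → x ∉ dom Γ →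
          Δ ⨾ (Γ , x ∶ A) ⊢ fv x ∶ A
  weak  : ∀ {Δ Γ A B C s x} → Δ ⨾ Γ ⊢ A ∶ B → Δ ⨾ Γ ⊢ C ∶ srt s → x ∉ dom Γ →
          Δ ⨾ (Γ , x ∶ C) ⊢ A ∶ B
  form  : ∀ {Δ Γ A B s₁ s₂ x} → Δ ⨾ Γ ⊢ A ∶ srt s₁ → x ∉ dom Γ → x ∉ fvs B →
          Δ ⨾ (Γ , x ∶ A) ⊢ (B ^^ fv x) ∶ srt s₂ → Δ ⨾ Γ ⊢ pi A B ∶ srt s₂
  appl  : ∀ {Δ Γ M N A B} → Δ ⨾ Γ ⊢ M ∶ pi A B → Δ ⨾ Γ ⊢ N ∶ A →
          Δ ⨾ Γ ⊢ app M N ∶ (B ^^ N)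
  abst  : ∀ {Δ Γ A M B s x} → x ∉ dom Γ → x ∉ fvs M → x ∉ fvs B →
          Δ ⨾ (Γ , x ∶ A) ⊢ (M ^^ fv x) ∶ (B ^^ fv x) → Δ ⨾ Γ ⊢ pi A B ∶ srt s →
          Δ ⨾ Γ ⊢ lam A M ∶ pi A B
  conv  : ∀ {Δ Γ A B B' s} → Δ ⨾ Γ ⊢ A ∶ B → Δ ⨾ Γ ⊢ B' ∶ srt s → Δ ⊢ B =βδ B' →
          Δ ⨾ Γ ⊢ A ∶ B'
  def   : ∀ {Δ Γ K L Γ' a M N} → Δ ⨾ Γ ⊢ K ∶ L → Δ ⨾ Γ' ⊢ M ∶ N → a ∉ names Δ →
          (Δ ▸ (Γ' ▹ a ≔ val M ∶ N)) ⨾ Γ ⊢ K ∶ L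
  defPN : ∀ {Δ Γ K L Γ' a N s} → Δ ⨾ Γ ⊢ K ∶ L → Δ ⨾ Γ' ⊢ N ∶ srt s → a ∉ names Δ →
          (Δ ▸ (Γ' ▹ a ≔ PN ∶ N)) ⨾ Γ ⊢ K ∶ L
  -- (inst) and (inst-prim) together: the body b is val M or PN
  inst  : ∀ {Δ Γ Γ' a b N Us} → Δ ⨾ Γ ⊢ srt ∗ ∶ srt □ →
          (Γ' ▹ a ≔ b ∶ N) ∈ᴱ Δ → length Us ≡ length (dom Γ') →
          (∀ {x A} → (x , A) ∈ entries Γ' →
             Δ ⨾ Γ ⊢ instSub Γ' Us x ∶ subst (instSub Γ' Us) A) →
          Δ ⨾ Γ ⊢ con a Us ∶ subst (instSub Γ' Us) N

Legal : Env → Set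
Legal Δ = ∃[ Γ ] ∃[ M ] ∃[ N ] (Δ ⨾ Γ ⊢ M ∶ N)

Indicator : Set
Indicator = Maybe Var     -- nothing = ε

data Line : Set where
  asm : Indicator → Var → Term → Line
  dfn : Indicator → Const → Term → Term → Line
  prm : Indicator → Const → Term → Line

Ident : Set
Ident = Var ⊎ Const

ident : Line → Ident
ident (asm _ z _) = inj₁ z
ident (dfn _ c _ _) = inj₂ c
ident (prm _ c _) = inj₂ c

indicator : Line → Indicator
indicator (asm y _ _) = y
indicator (dfn y _ _ _) = y
indicator (prm y _ _) = y

Book : Set
Book = List Line

ids : Book → List Ident
ids B = map ident B

Coherent : Book → Set
Coherent B =
  Unique (ids B) ×
  (∀ B₁ l B₂ z → B ≡ B₁ ++ (l ∷ B₂) → indicator l ≡ just z →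
     ∃[ y ] ∃[ A ] (asm y z A ∈ B₁))

data CtxOf (B : Book) : Indicator → Ctx → Set where
  ε    : CtxOf B nothing ∅
  step : ∀ {y z A Γ} → asm y z A ∈ B → CtxOf B y Γ → CtxOf B (just z) (Γ , z ∶ A)

-- Ok B Δ : B is ok and Δ = Δ_B
data Ok : Book → Env → Set where
  empty  : Ok [] ◇
  addAsm : ∀ {B Δ z x Γ A s} → Ok B Δ → inj₁ x ∉ ids B → CtxOf B z Γ →
           Δ ⨾ Γ ⊢ A ∶ srt s → Ok (B ∷ʳ asm z x A) Δ
  addDef : ∀ {B Δ z c Γ M A} → Ok B Δ → inj₂ c ∉ ids B → CtxOf B z Γ →
           Δ ⨾ Γ ⊢ M ∶ A → Ok (B ∷ʳ dfn z c M A) (Δ ▸ (Γ ▹ c ≔ val M ∶ A))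
  addPN  : ∀ {B Δ z c Γ A s} → Ok B Δ → inj₂ c ∉ ids B → CtxOf B z Γ →
           Δ ⨾ Γ ⊢ A ∶ srt s → Ok (B ∷ʳ prm z c A) (Δ ▸ (Γ ▹ c ≔ PN ∶ A))

IsOk : Book → Set
IsOk B = ∃[ Δ ] Ok B Δ

Clean : Book → Set
Clean B =
  Coherent B ×
  (∀ B₁ y x A B₂ → B ≡ B₁ ++ (asm y x A ∷ B₂) →
     ∃[ l ] (l ∈ B₂ × indicator l ≡ just x))

-- assumption lines ε ∗ x₁ := — : A₁, x₁ ∗ x₂ := — : A₂, … (renamed),
-- together with the last indicator (x_n, or ε if n = 0)
ctxLines : (Var → Var) → (Const → Const) → Ctx → List Line × Indicator
ctxLines σ ρ ∅ = [] , nothing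
ctxLines σ ρ (Γ , x ∶ A) =
  (proj₁ (ctxLines σ ρ Γ) ∷ʳ asm (proj₂ (ctxLines σ ρ Γ)) (σ x) (rename σ ρ A)) , just (σ x)

cluster : (Var → Var) → (Const → Const) → Def → List Line
cluster σ ρ (Γ ▹ a ≔ val M ∶ N) =
  proj₁ (ctxLines σ ρ Γ) ++ [ dfn (proj₂ (ctxLines σ ρ Γ)) (ρ a) (rename σ ρ M) (rename σ ρ N) ]
cluster σ ρ (Γ ▹ a ≔ PN ∶ N) =
  proj₁ (ctxLines σ ρ Γ) ++ [ prm (proj₂ (ctxLines σ ρ Γ)) (ρ a) (rename σ ρ N) ]

-- BookOf ρ Δ B : B is obtained from Δ by replacing each Dᵢ in order by its
-- cluster, with constants renamed consistently by the injection ρ and the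
-- variables of Dᵢ renamed by an injection σᵢ.
data BookOf (ρ : Const → Const) : Env → Book → Set where
  ◇   : BookOf ρ ◇ []
  snoc : ∀ {Δ B D} → BookOf ρ Δ B → (σ : Var → Var) → Injective _≡_ _≡_ σ →
         BookOf ρ (Δ ▸ D) (B ++ cluster σ ρ D)

{-# OPTIONS --safe #-}
module Submission where

-- Renaming variables and constants injectively transports λD derivations, even when
-- every definition of the environment gets its own variable renaming: δ-steps and
-- instantiations only inspect a definition at its parameters, and a derivable
-- definition mentions no other variables. Hence each line of B_Δ is typed by the
-- renamed premise of its definition, and B_Δ is ok with environment the renamed Δ.
-- Cleanliness is combinatorial: within a cluster each assumption x_i is the
-- indicator of the next line, and x_n that of the definition line.

open import Defs
open import Data.Nat using (ℕ; suc; _≟_)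
open import Data.Nat.Properties using (suc-injective)
open import Data.List using (List; []; _∷_; _++_; _∷ʳ_; length; map; [_])
open import Data.List.Properties using (map-++; length-map; ++-assoc; ++-identityʳ; ∷-injective)
open import Data.List.Membership.Propositional using (_∈_; _∉_)
open import Data.List.Membership.Propositional.Properties using (∈-map⁺; ∈-map⁻; ∈-++⁺ˡ; ∈-++⁺ʳ; ∈-++⁻)
open import Data.List.Relation.Unary.Any using (here; there)
open import Data.List.Relation.Unary.All using (All)
import Data.List.Relation.Unary.All as All
import Data.List.Relation.Unary.All.Properties as All
open import Data.List.Relation.Unary.AllPairs using ([]; _∷_)
open import Data.List.Relation.Unary.Unique.Propositional using (Unique)
import Data.List.Relation.Unary.Unique.Propositional.Properties as Unique
open import Data.List.Relation.Binary.Subset.Propositional using (_⊆_)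
open import Data.List.Relation.Binary.Subset.Propositional.Properties using (⊆-trans; xs⊆xs++ys; xs⊆ys++xs; ++⁺; ++⁺ʳ)
open import Data.Product using (_×_; _,_; ∃-syntax; proj₁; proj₂)
open import Data.Sum using (_⊎_; inj₁; inj₂; [_,_]′)
open import Data.Empty using (⊥-elim)
open import Data.Unit using (⊤; tt)
open import Data.Maybe using (just; nothing)
open import Relation.Nullary using (yes; no)
open import Relation.Binary.PropositionalEquality as ≡ using (_≡_; _≢_; refl; sym; trans; cong; cong₂)
import Relation.Binary.Construct.Closure.Equivalence as EqClosure
open import Function.Definitions using (Injective)

∉-map⁺ : ∀ {f : ℕ → ℕ} → Injective _≡_ _≡_ f → ∀ {x xs} → x ∉ xs → f x ∉ map f xs
∉-map⁺ f-inj x∉ fx∈ with ∈-map⁻ _ fx∈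
... | y , y∈ , fx≡fy with f-inj fx≡fy
... | refl = x∉ y∈

∈-∷ʳ⁺ : ∀ {A : Set} {x : A} xs → x ∈ xs ∷ʳ x
∈-∷ʳ⁺ xs = ∈-++⁺ʳ xs (here refl)

∈-∷ʳ⁻ : ∀ {A : Set} {x y : A} xs → x ∈ xs ∷ʳ y → x ∈ xs ⊎ x ≡ y
∈-∷ʳ⁻ xs p with ∈-++⁻ xs p
... | inj₁ q = inj₁ q
... | inj₂ (here q) = inj₂ q

⊆-∷ʳ : ∀ {A : Set} {xs ys : List A} {y} → xs ⊆ ys → xs ⊆ ys ∷ʳ y
⊆-∷ʳ {ys = ys} xs⊆ys = ⊆-trans xs⊆ys (xs⊆xs++ys ys _)

++-⊆ : ∀ {A : Set} {xs ys zs : List A} → xs ⊆ zs → ys ⊆ zs → xs ++ ys ⊆ zs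
++-⊆ {xs = xs} xs⊆ ys⊆ p = [ xs⊆ , ys⊆ ]′ (∈-++⁻ xs p)

++-⊆⁻ˡ : ∀ {A : Set} {xs ys zs : List A} → xs ++ ys ⊆ zs → xs ⊆ zs
++-⊆⁻ˡ = ⊆-trans (xs⊆xs++ys _ _)

++-⊆⁻ʳ : ∀ {A : Set} (xs : List A) {ys zs} → xs ++ ys ⊆ zs → ys ⊆ zs
++-⊆⁻ʳ xs = ⊆-trans (xs⊆ys++xs _ xs)

Unique-∷ʳ⁺ : ∀ {A : Set} {x : A} {xs} → Unique xs → x ∉ xs → Unique (xs ∷ʳ x)
Unique-∷ʳ⁺ u x∉ = Unique.++⁺ u (All.[] ∷ []) λ { (p , here refl) → x∉ p }

Unique-∷ʳ⁻ : ∀ {A : Set} {x : A} xs → Unique (xs ∷ʳ x) → Unique xs × x ∉ xs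
Unique-∷ʳ⁻ [] _ = [] , λ ()
Unique-∷ʳ⁻ (y ∷ xs) (y∉ ∷ u) with Unique-∷ʳ⁻ xs u
... | u′ , x∉ = All.++⁻ˡ xs y∉ ∷ u′ , λ where
  (here refl) → proj₂ (All.∷ʳ⁻ y∉) refl
  (there p) → x∉ p

Unique-++⁻ˡ : ∀ {A : Set} (xs : List A) {ys} → Unique (xs ++ ys) → Unique xs
Unique-++⁻ˡ [] _ = []
Unique-++⁻ˡ (x ∷ xs) (x∉ ∷ u) = All.++⁻ˡ xs x∉ ∷ Unique-++⁻ˡ xs u

mutual
  fvs⊆fvs-openAt : ∀ k u t → fvs t ⊆ fvs (openAt k u t)
  fvs⊆fvs-openAt k u (fv y) p = p
  fvs⊆fvs-openAt k u (con c ts) = fvss⊆fvss-openAts k u ts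
  fvs⊆fvs-openAt k u (lam A M) = ++⁺ (fvs⊆fvs-openAt k u A) (fvs⊆fvs-openAt (suc k) u M)
  fvs⊆fvs-openAt k u (pi A B) = ++⁺ (fvs⊆fvs-openAt k u A) (fvs⊆fvs-openAt (suc k) u B)
  fvs⊆fvs-openAt k u (app M N) = ++⁺ (fvs⊆fvs-openAt k u M) (fvs⊆fvs-openAt k u N)

  fvss⊆fvss-openAts : ∀ k u ts → fvss ts ⊆ fvss (openAts k u ts)
  fvss⊆fvss-openAts k u (t ∷ ts) = ++⁺ (fvs⊆fvs-openAt k u t) (fvss⊆fvss-openAts k u ts)

mutual
  fvs-openAt-⊆ : ∀ k u t {zs} → fvs t ⊆ zs → fvs u ⊆ zs → fvs (openAt k u t) ⊆ zs
  fvs-openAt-⊆ k u (srt s) t⊆ u⊆ ()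
  fvs-openAt-⊆ k u (bv i) t⊆ u⊆ with i ≟ k
  ... | yes _ = u⊆
  ... | no _ = t⊆
  fvs-openAt-⊆ k u (fv y) t⊆ u⊆ = t⊆
  fvs-openAt-⊆ k u (con c ts) t⊆ u⊆ = fvss-openAts-⊆ k u ts t⊆ u⊆
  fvs-openAt-⊆ k u (lam A M) t⊆ u⊆ =
    ++-⊆ (fvs-openAt-⊆ k u A (++-⊆⁻ˡ t⊆) u⊆) (fvs-openAt-⊆ (suc k) u M (++-⊆⁻ʳ (fvs A) t⊆) u⊆)
  fvs-openAt-⊆ k u (pi A B) t⊆ u⊆ =
    ++-⊆ (fvs-openAt-⊆ k u A (++-⊆⁻ˡ t⊆) u⊆) (fvs-openAt-⊆ (suc k) u B (++-⊆⁻ʳ (fvs A) t⊆) u⊆)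
  fvs-openAt-⊆ k u (app M N) t⊆ u⊆ =
    ++-⊆ (fvs-openAt-⊆ k u M (++-⊆⁻ˡ t⊆) u⊆) (fvs-openAt-⊆ k u N (++-⊆⁻ʳ (fvs M) t⊆) u⊆)

  fvss-openAts-⊆ : ∀ k u ts {zs} → fvss ts ⊆ zs → fvs u ⊆ zs → fvss (openAts k u ts) ⊆ zs
  fvss-openAts-⊆ k u [] ts⊆ u⊆ ()
  fvss-openAts-⊆ k u (t ∷ ts) ts⊆ u⊆ =
    ++-⊆ (fvs-openAt-⊆ k u t (++-⊆⁻ˡ ts⊆) u⊆) (fvss-openAts-⊆ k u ts (++-⊆⁻ʳ (fvs t) ts⊆) u⊆)

fvs-⊆-unopen : ∀ {x} t xs → x ∉ fvs t → fvs (t ^^ fv x) ⊆ xs ∷ʳ x → fvs t ⊆ xs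
fvs-⊆-unopen t xs x∉ opened⊆ p with ∈-∷ʳ⁻ xs (opened⊆ (fvs⊆fvs-openAt 0 _ t p))
... | inj₁ q = q
... | inj₂ refl = ⊥-elim (x∉ p)

mutual
  fvs-subst-⊆ : ∀ τ t {zs} → (∀ {y} → y ∈ fvs t → fvs (τ y) ⊆ zs) → fvs (subst τ t) ⊆ zs
  fvs-subst-⊆ τ (srt s) h ()
  fvs-subst-⊆ τ (bv i) h ()
  fvs-subst-⊆ τ (fv y) h = h (here refl)
  fvs-subst-⊆ τ (con c ts) h = fvss-substs-⊆ τ ts h
  fvs-subst-⊆ τ (lam A M) h =
    ++-⊆ (fvs-subst-⊆ τ A λ p → h (∈-++⁺ˡ p)) (fvs-subst-⊆ τ M λ p → h (∈-++⁺ʳ (fvs A) p))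
  fvs-subst-⊆ τ (pi A B) h =
    ++-⊆ (fvs-subst-⊆ τ A λ p → h (∈-++⁺ˡ p)) (fvs-subst-⊆ τ B λ p → h (∈-++⁺ʳ (fvs A) p))
  fvs-subst-⊆ τ (app M N) h =
    ++-⊆ (fvs-subst-⊆ τ M λ p → h (∈-++⁺ˡ p)) (fvs-subst-⊆ τ N λ p → h (∈-++⁺ʳ (fvs M) p))

  fvss-substs-⊆ : ∀ τ ts {zs} → (∀ {y} → y ∈ fvss ts → fvs (τ y) ⊆ zs) → fvss (substs τ ts) ⊆ zs
  fvss-substs-⊆ τ [] h ()
  fvss-substs-⊆ τ (t ∷ ts) h =
    ++-⊆ (fvs-subst-⊆ τ t λ p → h (∈-++⁺ˡ p)) (fvss-substs-⊆ τ ts λ p → h (∈-++⁺ʳ (fvs t) p))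

fvss-⊆ : ∀ ts {zs} → (∀ {t} → t ∈ ts → fvs t ⊆ zs) → fvss ts ⊆ zs
fvss-⊆ [] h ()
fvss-⊆ (t ∷ ts) h = ++-⊆ (h (here refl)) (fvss-⊆ ts λ t∈ → h (there t∈))

lookupSub-here : ∀ {x y ys u us} → x ≡ y → lookupSub (y ∷ ys) (u ∷ us) x ≡ u
lookupSub-here {x} {y} x≡y with x ≟ y
... | yes _ = refl
... | no x≢y = ⊥-elim (x≢y x≡y)

lookupSub-there : ∀ {x y ys u us} → x ≢ y → lookupSub (y ∷ ys) (u ∷ us) x ≡ lookupSub ys us x
lookupSub-there {x} {y} x≢y with x ≟ y
... | yes x≡y = ⊥-elim (x≢y x≡y)
... | no _ = refl

lookupSub-onto : ∀ ys us → Unique ys → length us ≡ length ys →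
                 ∀ {u} → u ∈ us → ∃[ y ] (y ∈ ys × lookupSub ys us y ≡ u)
lookupSub-onto (y ∷ ys) (u ∷ us) _ _ (here refl) = y , here refl , lookupSub-here {y} refl
lookupSub-onto (y ∷ ys) (u ∷ us) (y∉ ∷ u-ys) len (there u∈)
  with lookupSub-onto ys us u-ys (suc-injective len) u∈
... | z , z∈ , eq = z , there z∈ , trans (lookupSub-there λ z≡y → All.lookup y∉ z∈ (sym z≡y)) eq

fvss-⊆-lookupSub : ∀ ys us {zs} → Unique ys → length us ≡ length ys →
                   (∀ {y} → y ∈ ys → fvs (lookupSub ys us y) ⊆ zs) → fvss us ⊆ zs
fvss-⊆-lookupSub ys us u-ys len h = fvss-⊆ us λ u∈ → via-param (lookupSub-onto ys us u-ys len u∈)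
  where
  via-param : ∀ {u} → ∃[ y ] (y ∈ ys × lookupSub ys us y ≡ u) → fvs u ⊆ _
  via-param (y , y∈ , refl) = h y∈

module _ (σ : Var → Var) (ρ : Const → Const) where

  mutual
    fvs-rename : ∀ t → fvs (rename σ ρ t) ≡ map σ (fvs t)
    fvs-rename (srt s) = refl
    fvs-rename (bv i) = refl
    fvs-rename (fv x) = refl
    fvs-rename (con c ts) = fvss-renames ts
    fvs-rename (lam A M) = fvs-rename-++ A M
    fvs-rename (pi A B) = fvs-rename-++ A B
    fvs-rename (app M N) = fvs-rename-++ M N

    fvs-rename-++ : ∀ t u → fvs (rename σ ρ t) ++ fvs (rename σ ρ u) ≡ map σ (fvs t ++ fvs u)
    fvs-rename-++ t u = trans (cong₂ _++_ (fvs-rename t) (fvs-rename u)) (sym (map-++ σ (fvs t) (fvs u)))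

    fvss-renames : ∀ ts → fvss (renames σ ρ ts) ≡ map σ (fvss ts)
    fvss-renames [] = refl
    fvss-renames (t ∷ ts) =
      trans (cong₂ _++_ (fvs-rename t) (fvss-renames ts)) (sym (map-++ σ (fvs t) (fvss ts)))

  mutual
    rename-openAt : ∀ k u t → rename σ ρ (openAt k u t) ≡ openAt k (rename σ ρ u) (rename σ ρ t)
    rename-openAt k u (srt s) = refl
    rename-openAt k u (bv i) with i ≟ k
    ... | yes _ = refl
    ... | no _ = refl
    rename-openAt k u (fv x) = refl
    rename-openAt k u (con c ts) = cong (con (ρ c)) (renames-openAts k u ts)
    rename-openAt k u (lam A M) = cong₂ lam (rename-openAt k u A) (rename-openAt (suc k) u M)
    rename-openAt k u (pi A B) = cong₂ pi (rename-openAt k u A) (rename-openAt (suc k) u B)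
    rename-openAt k u (app M N) = cong₂ app (rename-openAt k u M) (rename-openAt k u N)

    renames-openAts : ∀ k u ts → renames σ ρ (openAts k u ts) ≡ openAts k (rename σ ρ u) (renames σ ρ ts)
    renames-openAts k u [] = refl
    renames-openAts k u (t ∷ ts) = cong₂ _∷_ (rename-openAt k u t) (renames-openAts k u ts)

  length-renames : ∀ ts → length (renames σ ρ ts) ≡ length ts
  length-renames [] = refl
  length-renames (t ∷ ts) = cong suc (length-renames ts)

  module _ (σ′ : Var → Var) where

    mutual
      rename-subst : ∀ τ τ′ t → (∀ {x} → x ∈ fvs t → rename σ ρ (τ x) ≡ τ′ (σ′ x)) →
                     rename σ ρ (subst τ t) ≡ subst τ′ (rename σ′ ρ t)
      rename-subst τ τ′ (srt s) h = refl
      rename-subst τ τ′ (bv i) h = refl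
      rename-subst τ τ′ (fv x) h = h (here refl)
      rename-subst τ τ′ (con c ts) h = cong (con (ρ c)) (renames-substs τ τ′ ts h)
      rename-subst τ τ′ (lam A M) h =
        cong₂ lam (rename-subst τ τ′ A λ p → h (∈-++⁺ˡ p))
                  (rename-subst τ τ′ M λ p → h (∈-++⁺ʳ (fvs A) p))
      rename-subst τ τ′ (pi A B) h =
        cong₂ pi (rename-subst τ τ′ A λ p → h (∈-++⁺ˡ p))
                 (rename-subst τ τ′ B λ p → h (∈-++⁺ʳ (fvs A) p))
      rename-subst τ τ′ (app M N) h =
        cong₂ app (rename-subst τ τ′ M λ p → h (∈-++⁺ˡ p))
                  (rename-subst τ τ′ N λ p → h (∈-++⁺ʳ (fvs M) p))

      renames-substs : ∀ τ τ′ ts → (∀ {x} → x ∈ fvss ts → rename σ ρ (τ x) ≡ τ′ (σ′ x)) →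
                       renames σ ρ (substs τ ts) ≡ substs τ′ (renames σ′ ρ ts)
      renames-substs τ τ′ [] h = refl
      renames-substs τ τ′ (t ∷ ts) h =
        cong₂ _∷_ (rename-subst τ τ′ t λ p → h (∈-++⁺ˡ p))
                  (renames-substs τ τ′ ts λ p → h (∈-++⁺ʳ (fvs t) p))

    rename-lookupSub : Injective _≡_ _≡_ σ′ → ∀ ys us {x} → x ∈ ys → length us ≡ length ys →
                       rename σ ρ (lookupSub ys us x) ≡ lookupSub (map σ′ ys) (renames σ ρ us) (σ′ x)
    rename-lookupSub σ′-inj (y ∷ ys) (u ∷ us) {x} x∈ len with x ≟ y | σ′ x ≟ σ′ y
    ... | yes _ | yes _ = refl
    ... | yes x≡y | no σ′x≢σ′y = ⊥-elim (σ′x≢σ′y (cong σ′ x≡y))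
    ... | no x≢y | yes σ′x≡σ′y = ⊥-elim (x≢y (σ′-inj σ′x≡σ′y))
    ... | no x≢y | no _ with x∈
    ...   | here x≡y = ⊥-elim (x≢y x≡y)
    ...   | there x∈ys = rename-lookupSub σ′-inj ys us x∈ys (suc-injective len)

renameCtx : (Var → Var) → (Const → Const) → Ctx → Ctx
renameCtx σ ρ ∅ = ∅
renameCtx σ ρ (Γ , x ∶ A) = renameCtx σ ρ Γ , σ x ∶ rename σ ρ A

renameEntry : (Var → Var) → (Const → Const) → Var × Term → Var × Term
renameEntry σ ρ (x , A) = σ x , rename σ ρ A

renameBody : (Var → Var) → (Const → Const) → Body → Body
renameBody σ ρ (val M) = val (rename σ ρ M)
renameBody σ ρ PN = PN

renameDef : (Var → Var) → (Const → Const) → Def → Def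
renameDef σ ρ (Γ ▹ a ≔ b ∶ N) = renameCtx σ ρ Γ ▹ ρ a ≔ renameBody σ ρ b ∶ rename σ ρ N

dom-renameCtx : ∀ σ ρ Γ → dom (renameCtx σ ρ Γ) ≡ map σ (dom Γ)
dom-renameCtx σ ρ ∅ = refl
dom-renameCtx σ ρ (Γ , x ∶ A) =
  trans (cong (_∷ʳ σ x) (dom-renameCtx σ ρ Γ)) (sym (map-++ σ (dom Γ) [ x ]))

entries-renameCtx : ∀ σ ρ Γ → entries (renameCtx σ ρ Γ) ≡ map (renameEntry σ ρ) (entries Γ)
entries-renameCtx σ ρ ∅ = refl
entries-renameCtx σ ρ (Γ , x ∶ A) =
  trans (cong (_∷ʳ renameEntry σ ρ (x , A)) (entries-renameCtx σ ρ Γ))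
        (sym (map-++ (renameEntry σ ρ) (entries Γ) [ x , A ]))

dom≡map-proj₁-entries : ∀ Γ → dom Γ ≡ map proj₁ (entries Γ)
dom≡map-proj₁-entries ∅ = refl
dom≡map-proj₁-entries (Γ , x ∶ A) =
  trans (cong (_∷ʳ x) (dom≡map-proj₁-entries Γ)) (sym (map-++ proj₁ (entries Γ) [ x , A ]))

∈-dom⁻ : ∀ Γ {x} → x ∈ dom Γ → ∃[ A ] ((x , A) ∈ entries Γ)
∈-dom⁻ Γ x∈ with ∈-map⁻ proj₁ (≡.subst (_ ∈_) (dom≡map-proj₁-entries Γ) x∈)
... | (_ , A) , x,A∈ , refl = A , x,A∈

∈-dom⁺ : ∀ Γ {x A} → (x , A) ∈ entries Γ → x ∈ dom Γ
∈-dom⁺ Γ x,A∈ = ≡.subst (_ ∈_) (sym (dom≡map-proj₁-entries Γ)) (∈-map⁺ proj₁ x,A∈)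

module _ (σ σ′ : Var → Var) (ρ : Const → Const) (σ′-inj : Injective _≡_ _≡_ σ′)
         (Γ : Ctx) (us : List Term) where

  rename-instSub : ∀ {x} → x ∈ dom Γ → length us ≡ length (dom Γ) →
                   rename σ ρ (instSub Γ us x) ≡ instSub (renameCtx σ′ ρ Γ) (renames σ ρ us) (σ′ x)
  rename-instSub x∈ len =
    trans (rename-lookupSub σ ρ σ′ σ′-inj (dom Γ) us x∈ len)
          (cong (λ ys → lookupSub ys (renames σ ρ us) (σ′ _)) (sym (dom-renameCtx σ′ ρ Γ)))

  rename-subst-instSub : ∀ t → length us ≡ length (dom Γ) → fvs t ⊆ dom Γ →
                         rename σ ρ (subst (instSub Γ us) t)
                           ≡ subst (instSub (renameCtx σ′ ρ Γ) (renames σ ρ us)) (rename σ′ ρ t)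
  rename-subst-instSub t len t⊆ = rename-subst σ ρ σ′ _ _ t λ x∈ → rename-instSub (t⊆ x∈) len

  length-renames-instance : length us ≡ length (dom Γ) →
                            length (renames σ ρ us) ≡ length (dom (renameCtx σ′ ρ Γ))
  length-renames-instance len = begin
    length (renames σ ρ us)       ≡⟨ length-renames σ ρ us ⟩
    length us                     ≡⟨ len ⟩
    length (dom Γ)                ≡⟨ sym (length-map σ′ (dom Γ)) ⟩
    length (map σ′ (dom Γ))       ≡⟨ cong length (sym (dom-renameCtx σ′ ρ Γ)) ⟩
    length (dom (renameCtx σ′ ρ Γ)) ∎
    where open ≡.≡-Reasoning

-- Scoping of derivations

EntriesScoped : Ctx → Set
EntriesScoped Γ = ∀ {x A} → (x , A) ∈ entries Γ → fvs A ⊆ dom Γ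

CtxScoped : Ctx → Set
CtxScoped Γ = Unique (dom Γ) × EntriesScoped Γ

Scoped : Ctx → Term → Term → Set
Scoped Γ M N = CtxScoped Γ × fvs M ⊆ dom Γ × fvs N ⊆ dom Γ

BodyScoped : Ctx → Body → Set
BodyScoped Γ (val M) = fvs M ⊆ dom Γ
BodyScoped Γ PN = ⊤

DefScoped : Def → Set
DefScoped (Γ ▹ a ≔ b ∶ N) = CtxScoped Γ × fvs N ⊆ dom Γ × BodyScoped Γ b

EnvScoped : Env → Set
EnvScoped Δ = All DefScoped (envList Δ)

ctxScoped-, : ∀ {Γ x A} → CtxScoped Γ → fvs A ⊆ dom Γ → x ∉ dom Γ → CtxScoped (Γ , x ∶ A)
ctxScoped-, {Γ} (u , entries⊆) A⊆ x∉ = Unique-∷ʳ⁺ u x∉ , entries,⊆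
  where
  entries,⊆ : EntriesScoped (Γ , _ ∶ _)
  entries,⊆ p with ∈-∷ʳ⁻ (entries Γ) p
  ... | inj₁ q = ⊆-∷ʳ (entries⊆ q)
  ... | inj₂ refl = ⊆-∷ʳ A⊆

-- Every argument is the instance of some parameter, because the parameters are distinct.
fvs-instance-⊆ : ∀ {Γ′ us N zs} → CtxScoped Γ′ → fvs N ⊆ dom Γ′ → length us ≡ length (dom Γ′) →
                 (∀ {x A} → (x , A) ∈ entries Γ′ → fvs (instSub Γ′ us x) ⊆ zs) →
                 fvss us ⊆ zs × fvs (subst (instSub Γ′ us) N) ⊆ zs
fvs-instance-⊆ {Γ′} {us} {N} (u , _) N⊆ len args⊆ =
  fvss-⊆-lookupSub (dom Γ′) us u len param⊆ , fvs-subst-⊆ (instSub Γ′ us) N (λ y∈ → param⊆ (N⊆ y∈))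
  where
  param⊆ : ∀ {y} → y ∈ dom Γ′ → fvs (instSub Γ′ us y) ⊆ _
  param⊆ y∈ = args⊆ (proj₂ (∈-dom⁻ Γ′ y∈))

⊢-scoped : ∀ {Δ Γ M N} → EnvScoped Δ → Δ ⨾ Γ ⊢ M ∶ N → Scoped Γ M N
⊢-scoped w sort = ([] , λ ()) , (λ ()) , (λ ())
⊢-scoped w (var {Γ = Γ} {A = A} d x∉) with ⊢-scoped w d
... | c , A⊆ , _ =
  ctxScoped-, {Γ} {_} {A} c A⊆ x∉ , (λ { (here refl) → ∈-∷ʳ⁺ (dom Γ) }) , ⊆-∷ʳ A⊆
⊢-scoped w (weak {Γ = Γ} {C = C} d dC x∉) with ⊢-scoped w d | ⊢-scoped w dC
... | c , M⊆ , N⊆ | _ , C⊆ , _ = ctxScoped-, {Γ} {_} {C} c C⊆ x∉ , ⊆-∷ʳ M⊆ , ⊆-∷ʳ N⊆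
⊢-scoped w (form {Γ = Γ} {B = B} dA _ x∉B dB) with ⊢-scoped w dA | ⊢-scoped w dB
... | c , A⊆ , _ | _ , B⊆ , _ = c , ++-⊆ A⊆ (fvs-⊆-unopen B (dom Γ) x∉B B⊆) , (λ ())
⊢-scoped w (appl {A = A} {B = B} dM dN) with ⊢-scoped w dM | ⊢-scoped w dN
... | c , M⊆ , AB⊆ | _ , N⊆ , _ =
  c , ++-⊆ M⊆ N⊆ , fvs-openAt-⊆ 0 _ B (++-⊆⁻ʳ (fvs A) AB⊆) N⊆
⊢-scoped w (abst {Γ = Γ} {M = M} _ x∉M _ dM dAB) with ⊢-scoped w dM | ⊢-scoped w dAB
... | _ , M⊆ , _ | c , AB⊆ , _ = c , ++-⊆ (++-⊆⁻ˡ AB⊆) (fvs-⊆-unopen M (dom Γ) x∉M M⊆) , AB⊆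
⊢-scoped w (conv dA dB′ _) with ⊢-scoped w dA | ⊢-scoped w dB′
... | c , A⊆ , _ | _ , B′⊆ , _ = c , A⊆ , B′⊆
⊢-scoped w (def d _ _) = ⊢-scoped (proj₁ (All.∷ʳ⁻ w)) d
⊢-scoped w (defPN d _ _) = ⊢-scoped (proj₁ (All.∷ʳ⁻ w)) d
⊢-scoped w (inst {Γ' = Γ′} {N = N} {Us = us} d D∈ len args) with ⊢-scoped w d | All.lookup w D∈
... | c , _ | c′ , N⊆ , _ =
  c , fvs-instance-⊆ {Γ′} {us} {N} c′ N⊆ len (λ p → proj₁ (proj₂ (⊢-scoped w (args p))))

⊢-envScoped : ∀ {Δ Γ M N} → Δ ⨾ Γ ⊢ M ∶ N → EnvScoped Δ
⊢-envScoped sort = All.[]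
⊢-envScoped (var d _) = ⊢-envScoped d
⊢-envScoped (weak d _ _) = ⊢-envScoped d
⊢-envScoped (form d _ _ _) = ⊢-envScoped d
⊢-envScoped (appl d _) = ⊢-envScoped d
⊢-envScoped (abst _ _ _ _ d) = ⊢-envScoped d
⊢-envScoped (conv d _ _) = ⊢-envScoped d
⊢-envScoped (def d dM _) with ⊢-scoped (⊢-envScoped dM) dM
... | c , M⊆ , N⊆ = All.∷ʳ⁺ (⊢-envScoped d) (c , N⊆ , M⊆)
⊢-envScoped (defPN d dN _) with ⊢-scoped (⊢-envScoped dN) dN
... | c , N⊆ , _ = All.∷ʳ⁺ (⊢-envScoped d) (c , N⊆ , tt)
⊢-envScoped (inst d _ _ _) = ⊢-envScoped d

WfCtx : Env → Ctx → Set
WfCtx Δ ∅ = ⊤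
WfCtx Δ (Γ , x ∶ A) = WfCtx Δ Γ × ∃[ s ] (Δ ⨾ Γ ⊢ A ∶ srt s)

WfCtx-map : ∀ {Δ Δ′} → (∀ {Γ A B} → Δ ⨾ Γ ⊢ A ∶ B → Δ′ ⨾ Γ ⊢ A ∶ B) → ∀ Γ → WfCtx Δ Γ → WfCtx Δ′ Γ
WfCtx-map f ∅ _ = tt
WfCtx-map f (Γ , x ∶ A) (wf , s , dA) = WfCtx-map f Γ wf , s , f dA

⊢-wfCtx : ∀ {Δ Γ M N} → Δ ⨾ Γ ⊢ M ∶ N → WfCtx Δ Γ
⊢-wfCtx sort = tt
⊢-wfCtx (var d _) = ⊢-wfCtx d , _ , d
⊢-wfCtx (weak _ dC _) = ⊢-wfCtx dC , _ , dC
⊢-wfCtx (form d _ _ _) = ⊢-wfCtx d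
⊢-wfCtx (appl d _) = ⊢-wfCtx d
⊢-wfCtx (abst _ _ _ _ d) = ⊢-wfCtx d
⊢-wfCtx (conv d _ _) = ⊢-wfCtx d
⊢-wfCtx {Γ = Γ} (def d dM a∉) = WfCtx-map (λ e → def e dM a∉) Γ (⊢-wfCtx d)
⊢-wfCtx {Γ = Γ} (defPN d dN a∉) = WfCtx-map (λ e → defPN e dN a∉) Γ (⊢-wfCtx d)
⊢-wfCtx (inst d _ _ _) = ⊢-wfCtx d

DefPremise : Env → Def → Set
DefPremise Δ (Γ ▹ a ≔ val M ∶ N) = Δ ⨾ Γ ⊢ M ∶ N
DefPremise Δ (Γ ▹ a ≔ PN ∶ N) = ∃[ s ] (Δ ⨾ Γ ⊢ N ∶ srt s)

legal-▸⁻ : ∀ {Δ D Γ M N} → (Δ ▸ D) ⨾ Γ ⊢ M ∶ N → Legal Δ × DefPremise Δ D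
legal-▸⁻ (var d _) = legal-▸⁻ d
legal-▸⁻ (weak d _ _) = legal-▸⁻ d
legal-▸⁻ (form d _ _ _) = legal-▸⁻ d
legal-▸⁻ (appl d _) = legal-▸⁻ d
legal-▸⁻ (abst _ _ _ _ d) = legal-▸⁻ d
legal-▸⁻ (conv d _ _) = legal-▸⁻ d
legal-▸⁻ (def d dM _) = (_ , _ , _ , d) , dM
legal-▸⁻ (defPN d dN _) = (_ , _ , _ , d) , (_ , dN)
legal-▸⁻ (inst d _ _ _) = legal-▸⁻ d

-- Renaming derivations

data RenamedEnv (ρ : Const → Const) : Env → Env → Set where
  ◇    : RenamedEnv ρ ◇ ◇
  snoc : ∀ {Δ Δ̂ D} → RenamedEnv ρ Δ Δ̂ → (σ : Var → Var) → Injective _≡_ _≡_ σ →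
         RenamedEnv ρ (Δ ▸ D) (Δ̂ ▸ renameDef σ ρ D)

cast⊢ : ∀ {Δ Γ M M′ N N′} → M ≡ M′ → N ≡ N′ → Δ ⨾ Γ ⊢ M ∶ N → Δ ⨾ Γ ⊢ M′ ∶ N′
cast⊢ refl refl d = d

cast⟶ : ∀ {Δ M M′ N N′} → M ≡ M′ → N ≡ N′ → Δ ⊢ M ⟶ N → Δ ⊢ M′ ⟶ N′
cast⟶ refl refl s = s

module _ (ρ : Const → Const) (ρ-inj : Injective _≡_ _≡_ ρ) where

  renamedEnv-∈ : ∀ {Δ Δ̂ D} → RenamedEnv ρ Δ Δ̂ → D ∈ᴱ Δ →
                 ∃[ σ ] (Injective _≡_ _≡_ σ × renameDef σ ρ D ∈ᴱ Δ̂)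
  renamedEnv-∈ {Δ ▸ _} {Δ̂ ▸ _} (snoc r σ σ-inj) D∈ with ∈-∷ʳ⁻ (envList Δ) D∈
  ... | inj₁ D∈Δ with renamedEnv-∈ r D∈Δ
  ...   | σ′ , σ′-inj , D̂∈ = σ′ , σ′-inj , ∈-++⁺ˡ D̂∈
  renamedEnv-∈ {Δ ▸ _} {Δ̂ ▸ _} (snoc r σ σ-inj) D∈ | inj₂ refl = σ , σ-inj , ∈-∷ʳ⁺ (envList Δ̂)

  names-▸ : ∀ Δ D → names (Δ ▸ D) ≡ names Δ ∷ʳ Def.name D
  names-▸ Δ D = map-++ Def.name (envList Δ) [ D ]

  renamedEnv-names⁻ : ∀ {Δ Δ̂ a} → RenamedEnv ρ Δ Δ̂ → ρ a ∈ names Δ̂ → a ∈ names Δ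
  renamedEnv-names⁻ {Δ ▸ D} {Δ̂ ▸ D̂} {a} (snoc r _ _) ρa∈
    with ∈-∷ʳ⁻ (names Δ̂) (≡.subst (ρ a ∈_) (names-▸ Δ̂ D̂) ρa∈)
  ... | inj₁ ρa∈Δ̂ = ≡.subst (a ∈_) (sym (names-▸ Δ D)) (∈-++⁺ˡ (renamedEnv-names⁻ r ρa∈Δ̂))
  ... | inj₂ ρa≡ with ρ-inj ρa≡
  ...   | refl = ≡.subst (a ∈_) (sym (names-▸ Δ D)) (∈-∷ʳ⁺ (names Δ))

  module _ (σ : Var → Var) (σ-inj : Injective _≡_ _≡_ σ) where

    ∉-dom-renameCtx : ∀ Γ {x} → x ∉ dom Γ → σ x ∉ dom (renameCtx σ ρ Γ)
    ∉-dom-renameCtx Γ x∉ p = ∉-map⁺ σ-inj x∉ (≡.subst (_ ∈_) (dom-renameCtx σ ρ Γ) p)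

    ∉-fvs-rename : ∀ t {x} → x ∉ fvs t → σ x ∉ fvs (rename σ ρ t)
    ∉-fvs-rename t x∉ p = ∉-map⁺ σ-inj x∉ (≡.subst (_ ∈_) (fvs-rename σ ρ t) p)

    mutual
      ⟶-rename : ∀ {Δ Δ̂ t t′} → EnvScoped Δ → RenamedEnv ρ Δ Δ̂ →
                 Δ ⊢ t ⟶ t′ → Δ̂ ⊢ rename σ ρ t ⟶ rename σ ρ t′
      ⟶-rename w r (β {M = M} {N = N}) = cast⟶ refl (sym (rename-openAt σ ρ 0 N M)) β
      ⟶-rename w r (δ {Γ} {M = M} {Us = us} D∈ len) with renamedEnv-∈ r D∈ | All.lookup w D∈
      ... | σ′ , σ′-inj , D̂∈ | _ , _ , M⊆ =
        cast⟶ refl (sym (rename-subst-instSub σ σ′ ρ σ′-inj Γ us M len M⊆))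
              (δ D̂∈ (length-renames-instance σ σ′ ρ σ′-inj Γ us len))
      ⟶-rename w r (conR s) = conR (⟶s-rename w r s)
      ⟶-rename w r (lamL s) = lamL (⟶-rename w r s)
      ⟶-rename w r (lamR {M = M} {M′} {x} x∉ x∉′ s) =
        lamR (∉-fvs-rename M x∉) (∉-fvs-rename M′ x∉′)
             (cast⟶ (rename-openAt σ ρ 0 (fv x) M) (rename-openAt σ ρ 0 (fv x) M′) (⟶-rename w r s))
      ⟶-rename w r (piL s) = piL (⟶-rename w r s)
      ⟶-rename w r (piR {B = B} {B′} {x} x∉ x∉′ s) =
        piR (∉-fvs-rename B x∉) (∉-fvs-rename B′ x∉′)
            (cast⟶ (rename-openAt σ ρ 0 (fv x) B) (rename-openAt σ ρ 0 (fv x) B′) (⟶-rename w r s))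
      ⟶-rename w r (appL s) = appL (⟶-rename w r s)
      ⟶-rename w r (appR s) = appR (⟶-rename w r s)

      ⟶s-rename : ∀ {Δ Δ̂ ts ts′} → EnvScoped Δ → RenamedEnv ρ Δ Δ̂ →
                  Δ ⊢ ts ⟶s ts′ → Δ̂ ⊢ renames σ ρ ts ⟶s renames σ ρ ts′
      ⟶s-rename w r (here s) = here (⟶-rename w r s)
      ⟶s-rename w r (there s) = there (⟶s-rename w r s)

  ⊢-rename : ∀ {Δ Δ̂ Γ M N} → Δ ⨾ Γ ⊢ M ∶ N → RenamedEnv ρ Δ Δ̂ → ∀ σ → Injective _≡_ _≡_ σ →
             Δ̂ ⨾ renameCtx σ ρ Γ ⊢ rename σ ρ M ∶ rename σ ρ N
  ⊢-rename sort ◇ σ σ-inj = sort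
  ⊢-rename (var {Γ = Γ} d x∉) r σ σ-inj = var (⊢-rename d r σ σ-inj) (∉-dom-renameCtx σ σ-inj Γ x∉)
  ⊢-rename (weak {Γ = Γ} d dC x∉) r σ σ-inj =
    weak (⊢-rename d r σ σ-inj) (⊢-rename dC r σ σ-inj) (∉-dom-renameCtx σ σ-inj Γ x∉)
  ⊢-rename (form {Γ = Γ} {B = B} {x = x} dA x∉ x∉B dB) r σ σ-inj =
    form (⊢-rename dA r σ σ-inj) (∉-dom-renameCtx σ σ-inj Γ x∉) (∉-fvs-rename σ σ-inj B x∉B)
         (cast⊢ (rename-openAt σ ρ 0 (fv x) B) refl (⊢-rename dB r σ σ-inj))
  ⊢-rename (appl {N = N} {B = B} dM dN) r σ σ-inj =
    cast⊢ refl (sym (rename-openAt σ ρ 0 N B)) (appl (⊢-rename dM r σ σ-inj) (⊢-rename dN r σ σ-inj))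
  ⊢-rename (abst {Γ = Γ} {M = M} {B = B} {x = x} x∉ x∉M x∉B dM dAB) r σ σ-inj =
    abst (∉-dom-renameCtx σ σ-inj Γ x∉) (∉-fvs-rename σ σ-inj M x∉M) (∉-fvs-rename σ σ-inj B x∉B)
         (cast⊢ (rename-openAt σ ρ 0 (fv x) M) (rename-openAt σ ρ 0 (fv x) B) (⊢-rename dM r σ σ-inj))
         (⊢-rename dAB r σ σ-inj)
  ⊢-rename (conv dA dB′ B=B′) r σ σ-inj =
    conv (⊢-rename dA r σ σ-inj) (⊢-rename dB′ r σ σ-inj)
         (EqClosure.gmap (rename σ ρ) (⟶-rename σ σ-inj (⊢-envScoped dA) r) B=B′)
  ⊢-rename (def d dM a∉) (snoc r σ′ σ′-inj) σ σ-inj =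
    def (⊢-rename d r σ σ-inj) (⊢-rename dM r σ′ σ′-inj) (λ ρa∈ → a∉ (renamedEnv-names⁻ r ρa∈))
  ⊢-rename (defPN d dN a∉) (snoc r σ′ σ′-inj) σ σ-inj =
    defPN (⊢-rename d r σ σ-inj) (⊢-rename dN r σ′ σ′-inj) (λ ρa∈ → a∉ (renamedEnv-names⁻ r ρa∈))
  ⊢-rename {Δ̂ = Δ̂} {Γ = Γ} (inst {Γ' = Γ′} {N = N} {Us = us} d D∈ len args) r σ σ-inj
    with renamedEnv-∈ r D∈ | All.lookup (⊢-envScoped d) D∈
  ... | σ′ , σ′-inj , D̂∈ | (_ , entries⊆) , N⊆ , _ =
    cast⊢ refl (sym (rename-subst-instSub σ σ′ ρ σ′-inj Γ′ us N len N⊆))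
          (inst (⊢-rename d r σ σ-inj) D̂∈ (length-renames-instance σ σ′ ρ σ′-inj Γ′ us len) args′)
    where
    Γ̂′ = renameCtx σ′ ρ Γ′
    ûs = renames σ ρ us
    args′ : ∀ {x′ A′} → (x′ , A′) ∈ entries Γ̂′ →
            Δ̂ ⨾ renameCtx σ ρ Γ ⊢ instSub Γ̂′ ûs x′ ∶ subst (instSub Γ̂′ ûs) A′
    args′ p with ∈-map⁻ (renameEntry σ′ ρ) (≡.subst (_ ∈_) (entries-renameCtx σ′ ρ Γ′) p)
    ... | (x , A) , x,A∈ , refl =
      cast⊢ (rename-instSub σ σ′ ρ σ′-inj Γ′ us (∈-dom⁺ Γ′ x,A∈) len)
            (rename-subst-instSub σ σ′ ρ σ′-inj Γ′ us A len (entries⊆ x,A∈))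
            (⊢-rename (args x,A∈) r σ σ-inj)

-- Cleanliness of the book

++-split : ∀ {X : Set} (P C B₁ : List X) {x B₂} → P ++ C ≡ B₁ ++ x ∷ B₂ →
           (∃[ B₂′ ] (P ≡ B₁ ++ x ∷ B₂′ × B₂ ≡ B₂′ ++ C)) ⊎
           (∃[ C₁ ] (B₁ ≡ P ++ C₁ × C ≡ C₁ ++ x ∷ B₂))
++-split [] C B₁ eq = inj₂ (B₁ , refl , eq)
++-split (p ∷ P) C [] refl = inj₁ (P , refl , refl)
++-split (p ∷ P) C (b ∷ B₁) eq with ∷-injective eq
... | refl , eq′ with ++-split P C B₁ eq′
...   | inj₁ (B₂′ , P≡ , B₂≡) = inj₁ (B₂′ , cong (p ∷_) P≡ , B₂≡)
...   | inj₂ (C₁ , B₁≡ , C≡) = inj₂ (C₁ , cong (p ∷_) B₁≡ , C≡)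

∷ʳ-split : ∀ {X : Set} (L B₁ : List X) {x y B₂} → L ∷ʳ y ≡ B₁ ++ x ∷ B₂ →
           (∃[ B₂′ ] (L ≡ B₁ ++ x ∷ B₂′ × B₂ ≡ B₂′ ∷ʳ y)) ⊎ (B₁ ≡ L × x ≡ y × B₂ ≡ [])
∷ʳ-split L B₁ eq with ++-split L [ _ ] B₁ eq
... | inj₁ before = inj₁ before
... | inj₂ ([] , refl , refl) = inj₂ (++-identityʳ L , refl , refl)
... | inj₂ (_ ∷ [] , _ , ())
... | inj₂ (_ ∷ _ ∷ _ , _ , ())

Declares : Book → Indicator → Set
Declares B e = ∀ z → e ≡ just z → ∃[ y ] ∃[ A ] (asm y z A ∈ B)

IndicatorsDeclared : Book → Set
IndicatorsDeclared B =
  ∀ B₁ l B₂ z → B ≡ B₁ ++ (l ∷ B₂) → indicator l ≡ just z → ∃[ y ] ∃[ A ] (asm y z A ∈ B₁)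

IndicatedIn : Book → Var → Set
IndicatedIn B x = ∃[ l ] (l ∈ B × indicator l ≡ just x)

NoDeadEnds : Book → Set
NoDeadEnds B = ∀ B₁ y x A B₂ → B ≡ B₁ ++ (asm y x A ∷ B₂) → IndicatedIn B₂ x

OnlyDeadEnd : Indicator → Book → Set
OnlyDeadEnd e B = ∀ B₁ y x A B₂ → B ≡ B₁ ++ (asm y x A ∷ B₂) → IndicatedIn B₂ x ⊎ e ≡ just x

indicatorsDeclared-[] : IndicatorsDeclared []
indicatorsDeclared-[] [] _ _ _ ()
indicatorsDeclared-[] (_ ∷ _) _ _ _ ()

onlyDeadEnd-[] : OnlyDeadEnd nothing []
onlyDeadEnd-[] [] _ _ _ _ ()
onlyDeadEnd-[] (_ ∷ _) _ _ _ _ ()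

noDeadEnds-[] : NoDeadEnds []
noDeadEnds-[] [] _ _ _ _ ()
noDeadEnds-[] (_ ∷ _) _ _ _ _ ()

indicatorsDeclared-++ : ∀ P C → IndicatorsDeclared P → IndicatorsDeclared C →
                        IndicatorsDeclared (P ++ C)
indicatorsDeclared-++ P C declaredP declaredC B₁ l B₂ z eq ind with ++-split P C B₁ eq
... | inj₁ (B₂′ , P≡ , _) = declaredP B₁ l B₂′ z P≡ ind
... | inj₂ (C₁ , refl , C≡) with declaredC C₁ l B₂ z C≡ ind
...   | y , A , z∈ = y , A , ∈-++⁺ʳ P z∈

noDeadEnds-++ : ∀ P C → NoDeadEnds P → NoDeadEnds C → NoDeadEnds (P ++ C)
noDeadEnds-++ P C cleanP cleanC B₁ y x A B₂ eq with ++-split P C B₁ eq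
... | inj₁ (B₂′ , P≡ , refl) with cleanP B₁ y x A B₂′ P≡
...   | l , l∈ , ind = l , ∈-++⁺ˡ l∈ , ind
noDeadEnds-++ P C cleanP cleanC B₁ y x A B₂ eq | inj₂ (C₁ , refl , C≡) = cleanC C₁ y x A B₂ C≡

indicatorsDeclared-∷ʳ : ∀ L {l} → IndicatorsDeclared L → Declares L (indicator l) →
                        IndicatorsDeclared (L ∷ʳ l)
indicatorsDeclared-∷ʳ L declared declares B₁ l B₂ z eq ind with ∷ʳ-split L B₁ eq
... | inj₁ (B₂′ , L≡ , _) = declared B₁ l B₂′ z L≡ ind
... | inj₂ (refl , refl , refl) = declares z ind

onlyDeadEnd-∷ʳ : ∀ L {e x A} → OnlyDeadEnd e L → OnlyDeadEnd (just x) (L ∷ʳ asm e x A)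
onlyDeadEnd-∷ʳ L {e} {x} {A} onlyDeadEnd B₁ y x′ A′ B₂ eq with ∷ʳ-split L B₁ eq
... | inj₁ (B₂′ , L≡ , refl) with onlyDeadEnd B₁ y x′ A′ B₂′ L≡
...   | inj₁ (l , l∈ , ind) = inj₁ (l , ∈-++⁺ˡ l∈ , ind)
...   | inj₂ e≡ = inj₁ (asm e x A , ∈-∷ʳ⁺ B₂′ , e≡)
onlyDeadEnd-∷ʳ L onlyDeadEnd B₁ y x′ A′ B₂ eq | inj₂ (refl , refl , refl) = inj₂ refl

noDeadEnds-∷ʳ : ∀ L {e l} → OnlyDeadEnd e L → indicator l ≡ e → (∀ y x A → l ≢ asm y x A) →
                NoDeadEnds (L ∷ʳ l)
noDeadEnds-∷ʳ L {l = l} onlyDeadEnd ind≡e not-asm B₁ y x A B₂ eq with ∷ʳ-split L B₁ eq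
... | inj₁ (B₂′ , L≡ , refl) with onlyDeadEnd B₁ y x A B₂′ L≡
...   | inj₁ (l′ , l′∈ , ind) = l′ , ∈-++⁺ˡ l′∈ , ind
...   | inj₂ e≡ = l , ∈-∷ʳ⁺ B₂′ , trans ind≡e e≡
noDeadEnds-∷ʳ L onlyDeadEnd ind≡e not-asm B₁ y x A B₂ eq | inj₂ (_ , asm≡l , _) =
  ⊥-elim (not-asm y x A (sym asm≡l))

AssumptionChain : Book → Indicator → Set
AssumptionChain L e = IndicatorsDeclared L × OnlyDeadEnd e L × Declares L e

ctxLines-chain : ∀ σ ρ Γ → AssumptionChain (proj₁ (ctxLines σ ρ Γ)) (proj₂ (ctxLines σ ρ Γ))
ctxLines-chain σ ρ ∅ = indicatorsDeclared-[] , onlyDeadEnd-[] , λ _ ()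
ctxLines-chain σ ρ (Γ , x ∶ A) with ctxLines σ ρ Γ | ctxLines-chain σ ρ Γ
... | L , e | declared , onlyDeadEnd , declares =
  indicatorsDeclared-∷ʳ L declared declares , onlyDeadEnd-∷ʳ L onlyDeadEnd ,
  λ { _ refl → e , rename σ ρ A , ∈-∷ʳ⁺ L }

chain-close : ∀ {L e} l → AssumptionChain L e → indicator l ≡ e → (∀ y x A → l ≢ asm y x A) →
              IndicatorsDeclared (L ∷ʳ l) × NoDeadEnds (L ∷ʳ l)
chain-close {L} l (declared , onlyDeadEnd , declares) refl not-asm =
  indicatorsDeclared-∷ʳ L declared declares , noDeadEnds-∷ʳ L onlyDeadEnd refl not-asm

cluster-clean : ∀ σ ρ D → IndicatorsDeclared (cluster σ ρ D) × NoDeadEnds (cluster σ ρ D)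
cluster-clean σ ρ (Γ ▹ a ≔ val M ∶ N) = chain-close _ (ctxLines-chain σ ρ Γ) refl λ _ _ _ ()
cluster-clean σ ρ (Γ ▹ a ≔ PN ∶ N) = chain-close _ (ctxLines-chain σ ρ Γ) refl λ _ _ _ ()

bookOf-clean : ∀ {ρ Δ B} → BookOf ρ Δ B → IndicatorsDeclared B × NoDeadEnds B
bookOf-clean ◇ = indicatorsDeclared-[] , noDeadEnds-[]
bookOf-clean {ρ} (snoc {B = B} {D} bookOf σ _) with bookOf-clean bookOf | cluster-clean σ ρ D
... | declaredB , cleanB | declaredD , cleanD =
  indicatorsDeclared-++ B _ declaredB declaredD , noDeadEnds-++ B _ cleanB cleanD

-- The book is ok

Unique-ids-++⁻ˡ : ∀ B C → Unique (ids (B ++ C)) → Unique (ids B)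
Unique-ids-++⁻ˡ B C u = Unique-++⁻ˡ (ids B) (≡.subst Unique (map-++ ident B C) u)

Unique-ids-++-∷ʳ⁻ : ∀ B L {l} → Unique (ids (B ++ L ∷ʳ l)) →
                    Unique (ids (B ++ L)) × ident l ∉ ids (B ++ L)
Unique-ids-++-∷ʳ⁻ B L {l} u = Unique-∷ʳ⁻ (ids (B ++ L)) (≡.subst Unique ids≡ u)
  where
  ids≡ : ids (B ++ L ∷ʳ l) ≡ ids (B ++ L) ∷ʳ ident l
  ids≡ = trans (cong ids (sym (++-assoc B L [ l ]))) (map-++ ident (B ++ L) [ l ])

ok-++-∷ʳ : ∀ B L {l Δ} → Ok ((B ++ L) ∷ʳ l) Δ → Ok (B ++ L ∷ʳ l) Δ
ok-++-∷ʳ B L {l} = ≡.subst (λ B′ → Ok B′ _) (++-assoc B L [ l ])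

CtxOf-mono : ∀ {B B′ z Γ} → B ⊆ B′ → CtxOf B z Γ → CtxOf B′ z Γ
CtxOf-mono B⊆B′ ε = ε
CtxOf-mono B⊆B′ (step asm∈ ctx) = step (B⊆B′ asm∈) (CtxOf-mono B⊆B′ ctx)

module _ (ρ : Const → Const) (ρ-inj : Injective _≡_ _≡_ ρ) where

  ok-ctxLines : ∀ {Δ Δ̂ B} → RenamedEnv ρ Δ Δ̂ → Ok B Δ̂ →
                ∀ σ → Injective _≡_ _≡_ σ → ∀ Γ → WfCtx Δ Γ →
                Unique (ids (B ++ proj₁ (ctxLines σ ρ Γ))) →
                Ok (B ++ proj₁ (ctxLines σ ρ Γ)) Δ̂ ×
                CtxOf (B ++ proj₁ (ctxLines σ ρ Γ)) (proj₂ (ctxLines σ ρ Γ)) (renameCtx σ ρ Γ)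
  ok-ctxLines {B = B} r ok σ σ-inj ∅ _ _ =
    ≡.subst (λ B′ → Ok B′ _) B≡ ok , ≡.subst (λ B′ → CtxOf B′ nothing ∅) B≡ ε
    where B≡ = sym (++-identityʳ B)
  ok-ctxLines {B = B} r ok σ σ-inj (Γ , x ∶ A) (wf , _ , dA) u
    with ctxLines σ ρ Γ | ok-ctxLines r ok σ σ-inj Γ wf
  ... | L , e | okL with Unique-ids-++-∷ʳ⁻ B L u
  ...   | uL , fresh with okL uL
  ...     | ok′ , ctx =
    ok-++-∷ʳ B L (addAsm ok′ fresh ctx (⊢-rename ρ ρ-inj dA r σ σ-inj)) ,
    step (∈-++⁺ʳ B (∈-∷ʳ⁺ L)) (CtxOf-mono (++⁺ʳ B (xs⊆xs++ys L _)) ctx)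

  ok-cluster : ∀ {Δ Δ̂ B} → RenamedEnv ρ Δ Δ̂ → Ok B Δ̂ →
               ∀ σ → Injective _≡_ _≡_ σ → ∀ D → DefPremise Δ D →
               Unique (ids (B ++ cluster σ ρ D)) → Ok (B ++ cluster σ ρ D) (Δ̂ ▸ renameDef σ ρ D)
  ok-cluster {B = B} r ok σ σ-inj (Γ ▹ a ≔ val M ∶ N) dM u
    with Unique-ids-++-∷ʳ⁻ B (proj₁ (ctxLines σ ρ Γ)) u
  ... | uL , fresh with ok-ctxLines r ok σ σ-inj Γ (⊢-wfCtx dM) uL
  ...   | okL , ctx = ok-++-∷ʳ B _ (addDef okL fresh ctx (⊢-rename ρ ρ-inj dM r σ σ-inj))
  ok-cluster {B = B} r ok σ σ-inj (Γ ▹ a ≔ PN ∶ N) (_ , dN) u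
    with Unique-ids-++-∷ʳ⁻ B (proj₁ (ctxLines σ ρ Γ)) u
  ... | uL , fresh with ok-ctxLines r ok σ σ-inj Γ (⊢-wfCtx dN) uL
  ...   | okL , ctx = ok-++-∷ʳ B _ (addPN okL fresh ctx (⊢-rename ρ ρ-inj dN r σ σ-inj))

  ok-bookOf : ∀ {Δ B} → BookOf ρ Δ B → Legal Δ → Unique (ids B) → ∃[ Δ̂ ] (Ok B Δ̂ × RenamedEnv ρ Δ Δ̂)
  ok-bookOf ◇ _ _ = ◇ , empty , ◇
  ok-bookOf (snoc {B = B} {D} bookOf σ σ-inj) (_ , _ , _ , d) u with legal-▸⁻ d
  ... | legal , premise with ok-bookOf bookOf legal (Unique-ids-++⁻ˡ B _ u)
  ...   | _ , ok , r = _ , ok-cluster r ok σ σ-inj D premise u , snoc r σ σ-inj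

lemma5 : (Δ : Env) → Legal Δ →
    (ρ : Const → Const) → Injective _≡_ _≡_ ρ →
    (B : Book) → BookOf ρ Δ B → Unique (ids B) →
    IsOk B × Clean B
lemma5 Δ legal ρ ρ-inj B bookOf u with ok-bookOf ρ ρ-inj bookOf legal u | bookOf-clean bookOf
... | Δ̂ , ok , _ | declared , noDeadEnds = (Δ̂ , ok) , (u , declared) , noDeadEnds
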